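{- Let $f:2^{\mathcal{N}}\to\mathbb{Z}_{\ge0}$ be a polymatroid on a nonempty finite ground set with $f(\{e\})>0$ for every $e\in\mathcal{N}$, and let $r=f(\mathcal{N})$. Let $q^*=\min\{|Q|:\emptyset\ne Q\subseteq\mathcal{N},\ Q\text{ is a quotient of }f\}$ and $k^*=\min_{A\subseteq\mathcal{N}:\,f(A)<f(\mathcal{N})}\left\lfloor\frac{\sum_{e\in\mathcal{N}}(f(A\cup\{e\})-f(A))}{f(\mathcal{N})-f(A)}\right\rfloor$. Then $\frac{q^*}{r}-1<k^*\le q^*$.
   Context: A polymatroid is an integer-valued, monotone, submodular set function with value $0$ on the empty set. A set $Q\subseteq\mathcal{N}$ is a quotient of $f$ if $f((\mathcal{N}\setminus Q)\cup\{e\})>f(\mathcal{N}\setminus Q)$ for every $e\in Q$. -}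

module Defs where

open import Data.Nat using (ℕ; zero; suc; _+_; _*_; _∸_; _≤_; _<_; _/_)
open import Data.Fin using (Fin)
open import Data.Fin.Subset using (Subset; ⊥; ⊤; ⁅_⁆; _∪_; _∩_; _⊆_; _∈_; ∁; ∣_∣; Nonempty)
open import Data.List using (map; allFin)
open import Data.Nat.ListAction using (sum)
open import Data.Product using (_×_; ∃)
open import Relation.Binary.PropositionalEquality using (_≡_)

record IsPolymatroid {n : ℕ} (f : Subset n → ℕ) : Set where
  field
    normalized : f ⊥ ≡ 0
    monotone   : ∀ {A B} → A ⊆ B → f A ≤ f B
    submodular : ∀ A B → f (A ∪ B) + f (A ∩ B) ≤ f A + f B

IsQuotient : {n : ℕ} → (Subset n → ℕ) → Subset n → Set
IsQuotient f Q = ∀ e → e ∈ Q → f (∁ Q) < f (∁ Q ∪ ⁅ e ⁆)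

IsMinQuotientSize : {n : ℕ} → (Subset n → ℕ) → ℕ → Set
IsMinQuotientSize f q =
  (∃ λ Q → Nonempty Q × IsQuotient f Q × ∣ Q ∣ ≡ q)
  × (∀ Q → Nonempty Q → IsQuotient f Q → q ≤ ∣ Q ∣)

-- floor division; the denominator is only ever positive where used
-- (the value at denominator 0 is irrelevant).
floorDiv : ℕ → ℕ → ℕ
floorDiv m zero    = 0
floorDiv m (suc d) = m / suc d

ratio : {n : ℕ} → (Subset n → ℕ) → Subset n → ℕ
ratio {n} f A =
  floorDiv (sum (map (λ e → f (A ∪ ⁅ e ⁆) ∸ f A) (allFin n))) (f ⊤ ∸ f A)

IsMinRatio : {n : ℕ} → (Subset n → ℕ) → ℕ → Set
IsMinRatio f k =
  (∃ λ A → f A < f ⊤ × ratio f A ≡ k)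
  × (∀ A → f A < f ⊤ → k ≤ ratio f A)

-- For a quotient Q, put A = N \ Q: the gain of every e ∉ Q over A is 0 and
-- that of every e ∈ Q is at most f(N) − f(A), so the ratio at A is at most |Q|;
-- hence k* ≤ q*. Conversely, let A attain k* and let Q be the set of elements
-- with positive gain over A, i.e. the complement of the closure of A. By
-- submodularity, adding elements of gain 0 to A one at a time never increases
-- f, so f(N \ Q) = f(A); this makes Q a nonempty quotient. Each e ∈ Q
-- contributes at least 1 to the gain sum S, so
-- q* ≤ |Q| ≤ S < (k* + 1)(f(N) − f(A)) ≤ (k* + 1) r.
module Submission where

open import Defs
open import Data.Nat using (ℕ; suc; _+_; _*_; _∸_; _/_; _≤_; _<_; z≤n; z<s; _≤?_)
open import Data.Nat.Properties
open import Data.Nat.DivMod using (m*n/n≡m; /-monoˡ-≤)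
open import Data.Nat.ListAction using (sum)
open import Data.Fin using (Fin; zero; suc)
open import Data.Fin.Subset using (Subset; ⊤; ⁅_⁆; _∪_; _∩_; _⊆_; _∈_; _∉_; ∁; ∣_∣; Nonempty; inside; outside)
open import Data.Fin.Subset.Properties
  using (nonempty?; drop-there; ⊆-refl; ⊆⊤; x∈⁅x⁆; x∈⁅y⁆⇒x≡y; x∈p⇒x∉∁p; x∈∁p⇒x∉p; x∉p⇒x∈∁p; x∉∁p⇒x∈p;
         p⊆p∪q; q⊆p∪q; x∈p∪q⁻; x∈p∪q⁺; x∈p∩q⁺)
open import Data.List using (List; []; _∷_; map; allFin; foldr; filter; tabulate)
open import Data.List.Properties using (map-tabulate)
open import Data.List.Relation.Unary.All using (All; []; _∷_)
open import Data.List.Relation.Unary.All.Properties using (all-filter)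
open import Data.List.Relation.Unary.Any using (here; there)
import Data.List.Membership.Propositional as List
open import Data.List.Membership.Propositional.Properties using (∈-allFin; ∈-filter⁺)
import Data.Vec as Vec
open import Data.Vec using (here; there)
open import Data.Vec.Properties using (lookup∘tabulate; []=⇒lookup; lookup⇒[]=)
open import Data.Product using (_×_; _,_)
open import Data.Sum using (inj₁; inj₂)
open import Level using (Level; 0ℓ)
open import Function using (id; _∘_)
open import Relation.Nullary using (yes; no; does; contradiction)
open import Relation.Nullary.Decidable using (dec-true)
open import Relation.Unary using (Pred; Decidable)
open import Relation.Binary.PropositionalEquality using (_≡_; refl; sym; trans; cong; subst)

private
  variable
    n : ℕ
    ℓ : Level

m<[floorDiv[m,n]+1]*n : ∀ m n → 0 < n → m < (floorDiv m n + 1) * n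
m<[floorDiv[m,n]+1]*n m (suc d) _ = ≰⇒> λ le →
  <⇒≱ (m<m+n (m / suc d) z<s)
      (≤-trans (≤-reflexive (sym (m*n/n≡m (m / suc d + 1) (suc d)))) (/-monoˡ-≤ (suc d) le))

m≤c*n⇒floorDiv[m,n]≤c : ∀ m n c → 0 < n → m ≤ c * n → floorDiv m n ≤ c
m≤c*n⇒floorDiv[m,n]≤c m (suc d) c _ le = ≤-trans (/-monoˡ-≤ (suc d) le) (≤-reflexive (m*n/n≡m c (suc d)))

∣p∣≤sum : ∀ (p : Subset n) (g : Fin n → ℕ) → (∀ e → e ∈ p → 1 ≤ g e) → ∣ p ∣ ≤ sum (tabulate g)
∣p∣≤sum Vec.[]            g pos = z≤n
∣p∣≤sum (inside  Vec.∷ p) g pos = +-mono-≤ (pos zero here) (∣p∣≤sum p (g ∘ suc) (λ e → pos (suc e) ∘ there))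
∣p∣≤sum (outside Vec.∷ p) g pos = ≤-trans (∣p∣≤sum p (g ∘ suc) (λ e → pos (suc e) ∘ there)) (m≤n+m _ (g zero))

sum≤∣p∣*c : ∀ (p : Subset n) (g : Fin n → ℕ) c →
            (∀ e → e ∈ p → g e ≤ c) → (∀ e → e ∉ p → g e ≡ 0) → sum (tabulate g) ≤ ∣ p ∣ * c
sum≤∣p∣*c Vec.[]            g c in≤ out≡0 = z≤n
sum≤∣p∣*c (inside  Vec.∷ p) g c in≤ out≡0 =
  +-mono-≤ (in≤ zero here) (sum≤∣p∣*c p (g ∘ suc) c (λ e → in≤ (suc e) ∘ there) (λ e → out≡0 (suc e) ∘ (_∘ drop-there)))
sum≤∣p∣*c (outside Vec.∷ p) g c in≤ out≡0 rewrite out≡0 zero λ () =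
  sum≤∣p∣*c p (g ∘ suc) c (λ e → in≤ (suc e) ∘ there) (λ e → out≡0 (suc e) ∘ (_∘ drop-there))

sum-map-allFin : (g : Fin n → ℕ) → sum (map g (allFin n)) ≡ sum (tabulate g)
sum-map-allFin g = cong sum (map-tabulate id g)

subsetOf : {P : Pred (Fin n) ℓ} → Decidable P → Subset n
subsetOf P? = Vec.tabulate (does ∘ P?)

∈-subsetOf⁻ : {P : Pred (Fin n) ℓ} (P? : Decidable P) {x : Fin n} → x ∈ subsetOf P? → P x
∈-subsetOf⁻ P? {x} x∈ with P? x | trans (sym (lookup∘tabulate (does ∘ P?) x)) ([]=⇒lookup x∈)
... | yes Px | _ = Px
... | no  _  | ()

∈-subsetOf⁺ : {P : Pred (Fin n) ℓ} (P? : Decidable P) {x : Fin n} → P x → x ∈ subsetOf P?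
∈-subsetOf⁺ P? {x} Px = lookup⇒[]= x (subsetOf P?) (trans (lookup∘tabulate (does ∘ P?) x) (dec-true (P? x) Px))

∪-mono-⊆ : {A B C D : Subset n} → A ⊆ B → C ⊆ D → A ∪ C ⊆ B ∪ D
∪-mono-⊆ {A = A} {C = C} A⊆B C⊆D x∈ with x∈p∪q⁻ A C x∈
... | inj₁ x∈A = x∈p∪q⁺ (inj₁ (A⊆B x∈A))
... | inj₂ x∈C = x∈p∪q⁺ (inj₂ (C⊆D x∈C))

x∈p⇒p∪⁅x⁆⊆p : {A : Subset n} {x : Fin n} → x ∈ A → A ∪ ⁅ x ⁆ ⊆ A
x∈p⇒p∪⁅x⁆⊆p {A = A} {x} x∈A y∈ with x∈p∪q⁻ A ⁅ x ⁆ y∈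
... | inj₁ y∈A = y∈A
... | inj₂ y∈x = subst (_∈ A) (sym (x∈⁅y⁆⇒x≡y x y∈x)) x∈A

∁∁p⊆p : {p : Subset n} → ∁ (∁ p) ⊆ p
∁∁p⊆p = x∉∁p⇒x∈p ∘ x∈∁p⇒x∉p

p⊆∁∁p : {p : Subset n} → p ⊆ ∁ (∁ p)
p⊆∁∁p = x∉p⇒x∈∁p ∘ x∈p⇒x∉∁p

insertAll : Subset n → List (Fin n) → Subset n
insertAll = foldr (λ e X → X ∪ ⁅ e ⁆)

⊆-insertAll : {A : Subset n} (L : List (Fin n)) → A ⊆ insertAll A L
⊆-insertAll []      = id
⊆-insertAll (e ∷ L) = p⊆p∪q ⁅ e ⁆ ∘ ⊆-insertAll L

∈-insertAll : {A : Subset n} {L : List (Fin n)} {e : Fin n} → e List.∈ L → e ∈ insertAll A L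
∈-insertAll {L = e ∷ L} (here refl) = q⊆p∪q (insertAll _ L) ⁅ e ⁆ (x∈⁅x⁆ e)
∈-insertAll {L = e ∷ L} (there e∈L) = p⊆p∪q ⁅ e ⁆ (∈-insertAll e∈L)

module Polymatroid {f : Subset n → ℕ} (P : IsPolymatroid f) where
  open IsPolymatroid P

  diminishing-returns : {A X : Subset n} (e : Fin n) → A ⊆ X →
                        f (X ∪ ⁅ e ⁆) + f A ≤ f X + f (A ∪ ⁅ e ⁆)
  diminishing-returns {A} {X} e A⊆X = begin
    f (X ∪ ⁅ e ⁆) + f A
      ≤⟨ +-mono-≤ (monotone (∪-mono-⊆ ⊆-refl (q⊆p∪q A ⁅ e ⁆)))
                  (monotone (λ x∈A → x∈p∩q⁺ (A⊆X x∈A , p⊆p∪q ⁅ e ⁆ x∈A))) ⟩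
    f (X ∪ (A ∪ ⁅ e ⁆)) + f (X ∩ (A ∪ ⁅ e ⁆))
      ≤⟨ submodular X (A ∪ ⁅ e ⁆) ⟩
    f X + f (A ∪ ⁅ e ⁆) ∎
    where open ≤-Reasoning

  InClosure : Subset n → Pred (Fin n) 0ℓ
  InClosure A e = f (A ∪ ⁅ e ⁆) ≤ f A

  InClosure? : (A : Subset n) → Decidable (InClosure A)
  InClosure? A e = f (A ∪ ⁅ e ⁆) ≤? f A

  closure : Subset n → Subset n
  closure A = subsetOf (InClosure? A)

  ⊆-closure : {A : Subset n} → A ⊆ closure A
  ⊆-closure {A} {x} x∈A = ∈-subsetOf⁺ (InClosure? A) (monotone (x∈p⇒p∪⁅x⁆⊆p x∈A))

  f-insertAll-closure≤ : {A : Subset n} (L : List (Fin n)) → All (InClosure A) L → f (insertAll A L) ≤ f A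
  f-insertAll-closure≤         []      []              = ≤-refl
  f-insertAll-closure≤ {A = A} (e ∷ L) (e∈cl ∷ L⊆cl) = +-cancelʳ-≤ (f A) _ _ (begin
    f (insertAll A L ∪ ⁅ e ⁆) + f A  ≤⟨ diminishing-returns e (⊆-insertAll L) ⟩
    f (insertAll A L) + f (A ∪ ⁅ e ⁆) ≤⟨ +-mono-≤ (f-insertAll-closure≤ L L⊆cl) e∈cl ⟩
    f A + f A                         ∎)
    where open ≤-Reasoning

  f-closure≤ : (A : Subset n) → f (closure A) ≤ f A
  f-closure≤ A = ≤-trans (monotone closure⊆) (f-insertAll-closure≤ zeroGain (all-filter (InClosure? A) (allFin n)))
    where
      zeroGain : List (Fin n)
      zeroGain = filter (InClosure? A) (allFin n)
      closure⊆ : closure A ⊆ insertAll A zeroGain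
      closure⊆ {x} x∈ = ∈-insertAll (∈-filter⁺ (InClosure? A) (∈-allFin x) (∈-subsetOf⁻ (InClosure? A) x∈))

  ∉-closure⇒gain : {A : Subset n} {e : Fin n} → e ∉ closure A → f A < f (A ∪ ⁅ e ⁆)
  ∉-closure⇒gain {A} e∉ = ≰⇒> (e∉ ∘ ∈-subsetOf⁺ (InClosure? A))

  ∁-closure-isQuotient : (A : Subset n) → IsQuotient f (∁ (closure A))
  ∁-closure-isQuotient A e e∈Q = begin-strict
    f (∁ (∁ (closure A)))         ≤⟨ monotone ∁∁p⊆p ⟩
    f (closure A)                 ≤⟨ f-closure≤ A ⟩
    f A                           <⟨ ∉-closure⇒gain (x∈∁p⇒x∉p e∈Q) ⟩
    f (A ∪ ⁅ e ⁆)                 ≤⟨ monotone (∪-mono-⊆ (p⊆∁∁p ∘ ⊆-closure) ⊆-refl) ⟩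
    f (∁ (∁ (closure A)) ∪ ⁅ e ⁆) ∎
    where open ≤-Reasoning

  ∁-closure-nonempty : {A : Subset n} → f A < f ⊤ → Nonempty (∁ (closure A))
  ∁-closure-nonempty {A} fA<f⊤ with nonempty? (∁ (closure A))
  ... | yes ne = ne
  ... | no empty = contradiction (≤-trans (monotone ⊤⊆closure) (f-closure≤ A)) (<⇒≱ fA<f⊤)
    where
      ⊤⊆closure : ⊤ ⊆ closure A
      ⊤⊆closure {x} _ = x∉∁p⇒x∈p λ x∈ → empty (x , x∈)

  ∣∁closure∣<[ratio+1]*f⊤ : {A : Subset n} → f A < f ⊤ → ∣ ∁ (closure A) ∣ < (ratio f A + 1) * f ⊤
  ∣∁closure∣<[ratio+1]*f⊤ {A} fA<f⊤ = begin-strict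
    ∣ ∁ (closure A) ∣                 ≤⟨ ∣p∣≤sum (∁ (closure A)) gain (λ e → m<n⇒0<n∸m ∘ ∉-closure⇒gain ∘ x∈∁p⇒x∉p) ⟩
    sum (tabulate gain)               ≡⟨ sum-map-allFin gain ⟨
    sum (map gain (allFin n))         <⟨ m<[floorDiv[m,n]+1]*n _ _ (m<n⇒0<n∸m fA<f⊤) ⟩
    (ratio f A + 1) * (f ⊤ ∸ f A)     ≤⟨ *-monoʳ-≤ (ratio f A + 1) (m∸n≤m (f ⊤) (f A)) ⟩
    (ratio f A + 1) * f ⊤             ∎
    where
      open ≤-Reasoning
      gain : Fin n → ℕ
      gain e = f (A ∪ ⁅ e ⁆) ∸ f A

  f∁Q<f⊤ : {Q : Subset n} → Nonempty Q → IsQuotient f Q → f (∁ Q) < f ⊤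
  f∁Q<f⊤ (e , e∈Q) quotient = <-≤-trans (quotient e e∈Q) (monotone ⊆⊤)

  ratio∁Q≤∣Q∣ : {Q : Subset n} → Nonempty Q → IsQuotient f Q → ratio f (∁ Q) ≤ ∣ Q ∣
  ratio∁Q≤∣Q∣ {Q} ne quotient =
    m≤c*n⇒floorDiv[m,n]≤c _ _ ∣ Q ∣ (m<n⇒0<n∸m (f∁Q<f⊤ ne quotient)) (begin
      sum (map gain (allFin n)) ≡⟨ sum-map-allFin gain ⟩
      sum (tabulate gain)       ≤⟨ sum≤∣p∣*c Q gain _ (λ e _ → ∸-monoˡ-≤ (f (∁ Q)) (monotone ⊆⊤)) gain-outside ⟩
      ∣ Q ∣ * (f ⊤ ∸ f (∁ Q))   ∎)
    where
      open ≤-Reasoning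
      gain : Fin n → ℕ
      gain e = f (∁ Q ∪ ⁅ e ⁆) ∸ f (∁ Q)
      gain-outside : ∀ e → e ∉ Q → gain e ≡ 0
      gain-outside e e∉Q = m≤n⇒m∸n≡0 (monotone (x∈p⇒p∪⁅x⁆⊆p (x∉p⇒x∈∁p e∉Q)))

lemmaA1 : (m : ℕ) → (f : Subset (suc m) → ℕ) → IsPolymatroid f
    → (∀ (e : Fin (suc m)) → 0 < f ⁅ e ⁆)
    → (q k : ℕ) → IsMinQuotientSize f q → IsMinRatio f k
    → (q < (k + 1) * f ⊤) × (k ≤ q)
lemmaA1 m f P _ q k ((Q , ne , quotient , ∣Q∣≡q) , q-min) ((A , fA<f⊤ , ratioA≡k) , k-min) =
  q<[k+1]*f⊤ , k≤q
  where
    open Polymatroid P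
    q<[k+1]*f⊤ : q < (k + 1) * f ⊤
    q<[k+1]*f⊤ = subst (λ r → q < (r + 1) * f ⊤) ratioA≡k
      (≤-<-trans (q-min _ (∁-closure-nonempty fA<f⊤) (∁-closure-isQuotient A)) (∣∁closure∣<[ratio+1]*f⊤ fA<f⊤))
    k≤q : k ≤ q
    k≤q = ≤-trans (k-min (∁ Q) (f∁Q<f⊤ ne quotient)) (subst (ratio f (∁ Q) ≤_) ∣Q∣≡q (ratio∁Q≤∣Q∣ ne quotient))
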